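{- In the Distant Bang Calculus, $\to_F^* \;=\; \to_S^*\,\to_I^*$; that is, for all terms $t,u$, $t\to_F^* u$ if and only if there is a term $s$ with $t\to_S^* s$ and $s\to_I^* u$.
   Context: Distant Bang Calculus. Terms: $t,u,s ::= x \mid t\,u \mid \lambda x.t \mid !t \mid \mathrm{der}(t) \mid t[x\backslash u]$; $\lambda x.t$ and $t[x\backslash u]$ bind $x$ in $t$; terms up to $\alpha$-conversion; $t\{x:=u\}$ is capture-avoiding substitution. Contexts have one hole $\square$, $C\langle t\rangle$ is plugging. Full contexts $F ::= \square \mid F\,t \mid t\,F \mid \lambda x.F \mid !F \mid \mathrm{der}(F) \mid F[x\backslash t] \mid t[x\backslash F]$; surface contexts $S ::= \square \mid S\,t \mid t\,S \mid \lambda x.S \mid \mathrm{der}(S) \mid S[x\backslash t] \mid t[x\backslash S]$; internal contexts $I ::= !F \mid S^*\langle I\rangle$ with $S^*$ a surface context different from $\square$ (the full contexts whose hole is under a $!$); list contexts $L ::= \square \mid L[x\backslash t]$. Rules (capture-free w.r.t. $L$): $(dB)$ $L\langle \lambda x.t\rangle\,u \mapsto L\langle t[x\backslash u]\rangle$; $(s!)$ $t[x\backslash L\langle !u\rangle] \mapsto L\langle t\{x:=u\}\rangle$; $(d!)$ $\mathrm{der}(L\langle !t\rangle) \mapsto L\langle t\rangle$. $\to_F$, $\to_S$, $\to_I$ are the closures of the three rules under full, surface and internal contexts respectively. -}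

module Defs where

-- Distant Bang Calculus, with well-scoped de Bruijn indices
-- (terms of type Term n have free variables among Fin n; alpha-equivalence
-- is syntactic equality).

open import Data.Nat using (ℕ; zero; suc)
open import Data.Fin using (Fin; zero; suc)
open import Data.Product using (∃; _×_; _,_)
open import Relation.Binary.PropositionalEquality using (_≡_)
open import Relation.Binary.Construct.Closure.ReflexiveTransitive using (Star)

infixl 7 _·_

data Term (n : ℕ) : Set where
  var : Fin n → Term n
  _·_ : Term n → Term n → Term n
  lam : Term (suc n) → Term n
  bang : Term n → Term n
  der : Term n → Term n
  es  : Term (suc n) → Term n → Term n        -- t[x\u], binds index 0 in t

Ren : ℕ → ℕ → Set
Ren n m = Fin n → Fin m

liftR : ∀ {n m} → Ren n m → Ren (suc n) (suc m)
liftR ρ zero = zero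
liftR ρ (suc i) = suc (ρ i)

rename : ∀ {n m} → Ren n m → Term n → Term m
rename ρ (var i) = var (ρ i)
rename ρ (t · u) = rename ρ t · rename ρ u
rename ρ (lam t) = lam (rename (liftR ρ) t)
rename ρ (bang t) = bang (rename ρ t)
rename ρ (der t) = der (rename ρ t)
rename ρ (es t u) = es (rename (liftR ρ) t) (rename ρ u)

Sub : ℕ → ℕ → Set
Sub n m = Fin n → Term m

liftS : ∀ {n m} → Sub n m → Sub (suc n) (suc m)
liftS σ zero = var zero
liftS σ (suc i) = rename suc (σ i)

subst : ∀ {n m} → Sub n m → Term n → Term m
subst σ (var i) = σ i
subst σ (t · u) = subst σ t · subst σ u
subst σ (lam t) = lam (subst (liftS σ) t)
subst σ (bang t) = bang (subst σ t)
subst σ (der t) = der (subst σ t)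
subst σ (es t u) = es (subst (liftS σ) t) (subst σ u)

sub0 : ∀ {n} → Term n → Sub (suc n) n
sub0 u zero = u
sub0 u (suc i) = var i

_⟦0≔_⟧ : ∀ {n} → Term (suc n) → Term n → Term n
t ⟦0≔ u ⟧ = subst (sub0 u) t

-- List contexts  L ::= □ | L[x\t]
-- LCtx n m : outer scope n, hole scope m (m = n + number of ES's)

data LCtx : ℕ → ℕ → Set where
  □  : ∀ {n} → LCtx n n
  _[_] : ∀ {n m} → LCtx (suc n) m → Term n → LCtx n m

plugL : ∀ {n m} → LCtx n m → Term m → Term n
plugL □ t = t
plugL (L [ s ]) t = es (plugL L t) s

-- the renaming weakening outer-scope terms past the binders of L
wkL : ∀ {n m} → LCtx n m → Ren n m
wkL □ i = i
wkL (L [ s ]) i = wkL L (suc i)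

data _↦_ {n : ℕ} : Term n → Term n → Set where
  dB : ∀ {m} (L : LCtx n m) (t : Term (suc m)) (u : Term n) →
       (plugL L (lam t) · u) ↦ plugL L (es t (rename (wkL L) u))
  s! : ∀ {m} (t : Term (suc n)) (L : LCtx n m) (u : Term m) →
       es t (plugL L (bang u)) ↦ plugL L ((rename (liftR (wkL L)) t) ⟦0≔ u ⟧)
  d! : ∀ {m} (L : LCtx n m) (t : Term m) →
       der (plugL L (bang t)) ↦ plugL L t

data FCtx : ℕ → ℕ → Set where
  □     : ∀ {n} → FCtx n n
  appL  : ∀ {n m} → FCtx n m → Term n → FCtx n m
  appR  : ∀ {n m} → Term n → FCtx n m → FCtx n m
  lam   : ∀ {n m} → FCtx (suc n) m → FCtx n m
  bang  : ∀ {n m} → FCtx n m → FCtx n m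
  der   : ∀ {n m} → FCtx n m → FCtx n m
  esL   : ∀ {n m} → FCtx (suc n) m → Term n → FCtx n m
  esR   : ∀ {n m} → Term (suc n) → FCtx n m → FCtx n m

plugF : ∀ {n m} → FCtx n m → Term m → Term n
plugF □ t = t
plugF (appL F s) t = plugF F t · s
plugF (appR s F) t = s · plugF F t
plugF (lam F) t = lam (plugF F t)
plugF (bang F) t = bang (plugF F t)
plugF (der F) t = der (plugF F t)
plugF (esL F s) t = es (plugF F t) s
plugF (esR s F) t = es s (plugF F t)

-- Surface contexts S (no hole under !)

data SCtx : ℕ → ℕ → Set where
  □     : ∀ {n} → SCtx n n
  appL  : ∀ {n m} → SCtx n m → Term n → SCtx n m
  appR  : ∀ {n m} → Term n → SCtx n m → SCtx n m
  lam   : ∀ {n m} → SCtx (suc n) m → SCtx n m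
  der   : ∀ {n m} → SCtx n m → SCtx n m
  esL   : ∀ {n m} → SCtx (suc n) m → Term n → SCtx n m
  esR   : ∀ {n m} → Term (suc n) → SCtx n m → SCtx n m

plugS : ∀ {n m} → SCtx n m → Term m → Term n
plugS □ t = t
plugS (appL S s) t = plugS S t · s
plugS (appR s S) t = s · plugS S t
plugS (lam S) t = lam (plugS S t)
plugS (der S) t = der (plugS S t)
plugS (esL S s) t = es (plugS S t) s
plugS (esR s S) t = es s (plugS S t)

data NonHole : ∀ {n m} → SCtx n m → Set where
  appL  : ∀ {n m} (S : SCtx n m) s → NonHole (appL S s)
  appR  : ∀ {n m} s (S : SCtx n m) → NonHole (appR s S)
  lam   : ∀ {n m} (S : SCtx (suc n) m) → NonHole (lam S)
  der   : ∀ {n m} (S : SCtx n m) → NonHole (der S)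
  esL   : ∀ {n m} (S : SCtx (suc n) m) s → NonHole (esL S s)
  esR   : ∀ {n m} s (S : SCtx n m) → NonHole (esR s S)

data ICtx : ℕ → ℕ → Set where
  bang  : ∀ {n m} → FCtx n m → ICtx n m
  surf  : ∀ {n k m} (S : SCtx n k) → NonHole S → ICtx k m → ICtx n m

plugI : ∀ {n m} → ICtx n m → Term m → Term n
plugI (bang F) t = bang (plugF F t)
plugI (surf S _ I) t = plugS S (plugI I t)

_→F_ : ∀ {n} → Term n → Term n → Set
_→F_ {n} t u = ∃ λ m → ∃ λ (F : FCtx n m) → ∃ λ t' → ∃ λ u' →
  (t ≡ plugF F t') × (u ≡ plugF F u') × (t' ↦ u')

_→S_ : ∀ {n} → Term n → Term n → Set
_→S_ {n} t u = ∃ λ m → ∃ λ (S : SCtx n m) → ∃ λ t' → ∃ λ u' →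
  (t ≡ plugS S t') × (u ≡ plugS S u') × (t' ↦ u')

_→I_ : ∀ {n} → Term n → Term n → Set
_→I_ {n} t u = ∃ λ m → ∃ λ (I : ICtx n m) → ∃ λ t' → ∃ λ u' →
  (t ≡ plugI I t') × (u ≡ plugI I u') × (t' ↦ u')

_→F*_ _→S*_ _→I*_ : ∀ {n} → Term n → Term n → Set
_→F*_ = Star _→F_
_→S*_ = Star _→S_
_→I*_ = Star _→I_

-- Takahashi's parallel-reduction method. Full reduction is sandwiched between one-step
-- full reduction and full parallel reduction ⇛, so →F* = ⇛*. Every ⇛ step factors as
-- surface steps followed by one internal parallel step ⇒I (fire the redexes outside !
-- first; substitution is compatible with this). An internal parallel step followed by a
-- surface step can be rearranged into a surface step followed by a ⇛ step, which factors
-- again; iterating this postpones all internal work to the end.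
module Submission where

open import Defs
open import Data.Nat using (ℕ; suc; _≤_)
open import Data.Nat.Properties using (≤-refl; <⇒≤; <-irrefl)
open import Data.Fin using (zero; suc)
open import Data.Empty using (⊥-elim)
open import Data.Product using (∃; ∃-syntax; _×_; _,_)
open import Function.Base using (id; _∘_)
open import Function.Bundles using (_⇔_; mk⇔)
open import Relation.Binary.PropositionalEquality
  using (_≡_; _≗_; refl; sym; trans; cong; cong₂; subst₂; module ≡-Reasoning)
  renaming (subst to transport)
open import Relation.Binary.Construct.Closure.ReflexiveTransitive
  using (Star; ε; _◅_; _◅◅_; gmap; map; kleisliStar)

open ≡-Reasoning

liftR-cong : ∀ {n m} {ρ ρ' : Ren n m} → ρ ≗ ρ' → liftR ρ ≗ liftR ρ'
liftR-cong e zero = refl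
liftR-cong e (suc i) = cong suc (e i)

rename-cong : ∀ {n m} {ρ ρ' : Ren n m} → ρ ≗ ρ' → rename ρ ≗ rename ρ'
rename-cong e (var i) = cong var (e i)
rename-cong e (t · u) = cong₂ _·_ (rename-cong e t) (rename-cong e u)
rename-cong e (lam t) = cong lam (rename-cong (liftR-cong e) t)
rename-cong e (bang t) = cong bang (rename-cong e t)
rename-cong e (der t) = cong der (rename-cong e t)
rename-cong e (es t u) = cong₂ es (rename-cong (liftR-cong e) t) (rename-cong e u)

liftS-cong : ∀ {n m} {σ σ' : Sub n m} → σ ≗ σ' → liftS σ ≗ liftS σ'
liftS-cong e zero = refl
liftS-cong e (suc i) = cong (rename suc) (e i)

subst-cong : ∀ {n m} {σ σ' : Sub n m} → σ ≗ σ' → subst σ ≗ subst σ'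
subst-cong e (var i) = e i
subst-cong e (t · u) = cong₂ _·_ (subst-cong e t) (subst-cong e u)
subst-cong e (lam t) = cong lam (subst-cong (liftS-cong e) t)
subst-cong e (bang t) = cong bang (subst-cong e t)
subst-cong e (der t) = cong der (subst-cong e t)
subst-cong e (es t u) = cong₂ es (subst-cong (liftS-cong e) t) (subst-cong e u)

liftR-id : ∀ {n} → liftR {n} id ≗ id
liftR-id zero = refl
liftR-id (suc i) = refl

rename-id : ∀ {n} → rename {n} id ≗ id
rename-id (var i) = refl
rename-id (t · u) = cong₂ _·_ (rename-id t) (rename-id u)
rename-id (lam t) = cong lam (trans (rename-cong liftR-id t) (rename-id t))
rename-id (bang t) = cong bang (rename-id t)
rename-id (der t) = cong der (rename-id t)
rename-id (es t u) = cong₂ es (trans (rename-cong liftR-id t) (rename-id t)) (rename-id u)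

liftR-∘ : ∀ {n m k} (ρ : Ren m k) (ρ' : Ren n m) → liftR ρ ∘ liftR ρ' ≗ liftR (ρ ∘ ρ')
liftR-∘ ρ ρ' zero = refl
liftR-∘ ρ ρ' (suc i) = refl

rename-∘ : ∀ {n m k} (ρ : Ren m k) (ρ' : Ren n m) → rename ρ ∘ rename ρ' ≗ rename (ρ ∘ ρ')
rename-∘ ρ ρ' (var i) = refl
rename-∘ ρ ρ' (t · u) = cong₂ _·_ (rename-∘ ρ ρ' t) (rename-∘ ρ ρ' u)
rename-∘ ρ ρ' (lam t) =
  cong lam (trans (rename-∘ (liftR ρ) (liftR ρ') t) (rename-cong (liftR-∘ ρ ρ') t))
rename-∘ ρ ρ' (bang t) = cong bang (rename-∘ ρ ρ' t)
rename-∘ ρ ρ' (der t) = cong der (rename-∘ ρ ρ' t)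
rename-∘ ρ ρ' (es t u) =
  cong₂ es (trans (rename-∘ (liftR ρ) (liftR ρ') t) (rename-cong (liftR-∘ ρ ρ') t))
           (rename-∘ ρ ρ' u)

liftS-liftR : ∀ {n m k} (σ : Sub m k) (ρ : Ren n m) → liftS σ ∘ liftR ρ ≗ liftS (σ ∘ ρ)
liftS-liftR σ ρ zero = refl
liftS-liftR σ ρ (suc i) = refl

subst-rename : ∀ {n m k} (σ : Sub m k) (ρ : Ren n m) → subst σ ∘ rename ρ ≗ subst (σ ∘ ρ)
subst-rename σ ρ (var i) = refl
subst-rename σ ρ (t · u) = cong₂ _·_ (subst-rename σ ρ t) (subst-rename σ ρ u)
subst-rename σ ρ (lam t) =
  cong lam (trans (subst-rename (liftS σ) (liftR ρ) t) (subst-cong (liftS-liftR σ ρ) t))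
subst-rename σ ρ (bang t) = cong bang (subst-rename σ ρ t)
subst-rename σ ρ (der t) = cong der (subst-rename σ ρ t)
subst-rename σ ρ (es t u) =
  cong₂ es (trans (subst-rename (liftS σ) (liftR ρ) t) (subst-cong (liftS-liftR σ ρ) t))
           (subst-rename σ ρ u)

liftR-liftS : ∀ {n m k} (ρ : Ren m k) (σ : Sub n m) →
  rename (liftR ρ) ∘ liftS σ ≗ liftS (rename ρ ∘ σ)
liftR-liftS ρ σ zero = refl
liftR-liftS ρ σ (suc i) = trans (rename-∘ (liftR ρ) suc (σ i)) (sym (rename-∘ suc ρ (σ i)))

rename-subst : ∀ {n m k} (ρ : Ren m k) (σ : Sub n m) → rename ρ ∘ subst σ ≗ subst (rename ρ ∘ σ)
rename-subst ρ σ (var i) = refl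
rename-subst ρ σ (t · u) = cong₂ _·_ (rename-subst ρ σ t) (rename-subst ρ σ u)
rename-subst ρ σ (lam t) =
  cong lam (trans (rename-subst (liftR ρ) (liftS σ) t) (subst-cong (liftR-liftS ρ σ) t))
rename-subst ρ σ (bang t) = cong bang (rename-subst ρ σ t)
rename-subst ρ σ (der t) = cong der (rename-subst ρ σ t)
rename-subst ρ σ (es t u) =
  cong₂ es (trans (rename-subst (liftR ρ) (liftS σ) t) (subst-cong (liftR-liftS ρ σ) t))
           (rename-subst ρ σ u)

liftS-∘ : ∀ {n m k} (σ : Sub m k) (τ : Sub n m) →
  subst (liftS σ) ∘ liftS τ ≗ liftS (subst σ ∘ τ)
liftS-∘ σ τ zero = refl
liftS-∘ σ τ (suc i) = trans (subst-rename (liftS σ) suc (τ i)) (sym (rename-subst suc σ (τ i)))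

subst-∘ : ∀ {n m k} (σ : Sub m k) (τ : Sub n m) → subst σ ∘ subst τ ≗ subst (subst σ ∘ τ)
subst-∘ σ τ (var i) = refl
subst-∘ σ τ (t · u) = cong₂ _·_ (subst-∘ σ τ t) (subst-∘ σ τ u)
subst-∘ σ τ (lam t) =
  cong lam (trans (subst-∘ (liftS σ) (liftS τ) t) (subst-cong (liftS-∘ σ τ) t))
subst-∘ σ τ (bang t) = cong bang (subst-∘ σ τ t)
subst-∘ σ τ (der t) = cong der (subst-∘ σ τ t)
subst-∘ σ τ (es t u) =
  cong₂ es (trans (subst-∘ (liftS σ) (liftS τ) t) (subst-cong (liftS-∘ σ τ) t))
           (subst-∘ σ τ u)

liftR-as-liftS : ∀ {n m} (ρ : Ren n m) → var ∘ liftR ρ ≗ liftS (var ∘ ρ)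
liftR-as-liftS ρ zero = refl
liftR-as-liftS ρ (suc i) = refl

rename-as-subst : ∀ {n m} (ρ : Ren n m) → rename ρ ≗ subst (var ∘ ρ)
rename-as-subst ρ (var i) = refl
rename-as-subst ρ (t · u) = cong₂ _·_ (rename-as-subst ρ t) (rename-as-subst ρ u)
rename-as-subst ρ (lam t) =
  cong lam (trans (rename-as-subst (liftR ρ) t) (subst-cong (liftR-as-liftS ρ) t))
rename-as-subst ρ (bang t) = cong bang (rename-as-subst ρ t)
rename-as-subst ρ (der t) = cong der (rename-as-subst ρ t)
rename-as-subst ρ (es t u) =
  cong₂ es (trans (rename-as-subst (liftR ρ) t) (subst-cong (liftR-as-liftS ρ) t))
           (rename-as-subst ρ u)

subst-rename-commute : ∀ {n n' m m'} {σ : Sub n n'} {τ : Sub m m'} {w : Ren n m} {w' : Ren n' m'} →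
  τ ∘ w ≗ rename w' ∘ σ → subst τ ∘ rename w ≗ rename w' ∘ subst σ
subst-rename-commute {σ = σ} {τ} {w} {w'} square u =
  trans (subst-rename τ w u) (trans (subst-cong square u) (sym (rename-subst w' σ u)))

subst-⟦0≔⟧ : ∀ {n n' m m'} {σ : Sub n n'} {τ : Sub m m'} {w : Ren n m} {w' : Ren n' m'} →
  τ ∘ w ≗ rename w' ∘ σ → ∀ t u →
  subst τ (rename (liftR w) t ⟦0≔ u ⟧) ≡ rename (liftR w') (subst (liftS σ) t) ⟦0≔ subst τ u ⟧
subst-⟦0≔⟧ {σ = σ} {τ} {w} {w'} square t u = begin
    subst τ (subst (sub0 u) (rename (liftR w) t))
  ≡⟨ subst-∘ τ (sub0 u) (rename (liftR w) t) ⟩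
    subst (subst τ ∘ sub0 u) (rename (liftR w) t)
  ≡⟨ subst-rename (subst τ ∘ sub0 u) (liftR w) t ⟩
    subst (subst τ ∘ sub0 u ∘ liftR w) t
  ≡⟨ subst-cong pointwise t ⟩
    subst (subst (sub0 v) ∘ rename (liftR w') ∘ liftS σ) t
  ≡⟨ sym (subst-∘ (sub0 v) (rename (liftR w') ∘ liftS σ) t) ⟩
    subst (sub0 v) (subst (rename (liftR w') ∘ liftS σ) t)
  ≡⟨ cong (subst (sub0 v)) (sym (rename-subst (liftR w') (liftS σ) t)) ⟩
    subst (sub0 v) (rename (liftR w') (subst (liftS σ) t))
  ∎
  where
  v = subst τ u
  pointwise : subst τ ∘ sub0 u ∘ liftR w ≗ subst (sub0 v) ∘ rename (liftR w') ∘ liftS σ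
  pointwise zero = refl
  pointwise (suc i) = begin
      τ (w i)
    ≡⟨ square i ⟩
      rename w' (σ i)
    ≡⟨ rename-as-subst w' (σ i) ⟩
      subst (var ∘ w') (σ i)
    ≡⟨ sym (subst-rename (sub0 v) (suc ∘ w') (σ i)) ⟩
      subst (sub0 v) (rename (suc ∘ w') (σ i))
    ≡⟨ cong (subst (sub0 v)) (sym (rename-∘ (liftR w') suc (σ i))) ⟩
      subst (sub0 v) (rename (liftR w') (rename suc (σ i)))
    ∎

LCtx-≤ : ∀ {n m} → LCtx n m → n ≤ m
LCtx-≤ □ = ≤-refl
LCtx-≤ (L [ _ ]) = <⇒≤ (LCtx-≤ L)

wkL-irrelevant : ∀ {n m} (L L' : LCtx n m) → wkL L ≗ wkL L'
wkL-irrelevant □ □ i = refl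
wkL-irrelevant □ (L' [ _ ]) = ⊥-elim (<-irrefl refl (LCtx-≤ L'))
wkL-irrelevant (L [ _ ]) □ = ⊥-elim (<-irrefl refl (LCtx-≤ L))
wkL-irrelevant (L [ _ ]) (L' [ _ ]) i = wkL-irrelevant L L' (suc i)

TermRel : Set₁
TermRel = ∀ {n} → Term n → Term n → Set

data Pointwise (R : TermRel) : ∀ {n m} → LCtx n m → LCtx n m → Set where
  □ : ∀ {n} → Pointwise R {n} □ □
  _[_] : ∀ {n m} {L L' : LCtx (suc n) m} {s s' : Term n} →
    Pointwise R L L' → R s s' → Pointwise R (L [ s ]) (L' [ s' ])

Pointwise-refl : ∀ {R : TermRel} → (∀ {n} (t : Term n) → R t t) →
  ∀ {n m} (L : LCtx n m) → Pointwise R L L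
Pointwise-refl r □ = □
Pointwise-refl r (L [ s ]) = Pointwise-refl r L [ r s ]

Pointwise-map : ∀ {R R' : TermRel} → (∀ {n} {t t' : Term n} → R t t' → R' t t') →
  ∀ {n m} {L L' : LCtx n m} → Pointwise R L L' → Pointwise R' L L'
Pointwise-map f □ = □
Pointwise-map f (l [ r ]) = Pointwise-map f l [ f r ]

Pointwise-plugL : ∀ {R : TermRel} →
  (∀ {n} {t t' : Term (suc n)} {s s' : Term n} → R t t' → R s s' → R (es t s) (es t' s')) →
  ∀ {n m} {L L' : LCtx n m} {X X'} → Pointwise R L L' → R X X' → R (plugL L X) (plugL L' X')
Pointwise-plugL r-es □ x = x
Pointwise-plugL r-es (l [ s ]) x = r-es (Pointwise-plugL r-es l x) s

_∘S_ : ∀ {n k m} → SCtx n k → SCtx k m → SCtx n m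
□ ∘S S' = S'
appL S s ∘S S' = appL (S ∘S S') s
appR s S ∘S S' = appR s (S ∘S S')
lam S ∘S S' = lam (S ∘S S')
der S ∘S S' = der (S ∘S S')
esL S s ∘S S' = esL (S ∘S S') s
esR s S ∘S S' = esR s (S ∘S S')

plugS-∘ : ∀ {n k m} (S : SCtx n k) (S' : SCtx k m) t → plugS S (plugS S' t) ≡ plugS (S ∘S S') t
plugS-∘ □ S' t = refl
plugS-∘ (appL S s) S' t = cong (_· s) (plugS-∘ S S' t)
plugS-∘ (appR s S) S' t = cong (s ·_) (plugS-∘ S S' t)
plugS-∘ (lam S) S' t = cong lam (plugS-∘ S S' t)
plugS-∘ (der S) S' t = cong der (plugS-∘ S S' t)
plugS-∘ (esL S s) S' t = cong (λ z → es z s) (plugS-∘ S S' t)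
plugS-∘ (esR s S) S' t = cong (es s) (plugS-∘ S S' t)

_∘F_ : ∀ {n k m} → FCtx n k → FCtx k m → FCtx n m
□ ∘F F' = F'
appL F s ∘F F' = appL (F ∘F F') s
appR s F ∘F F' = appR s (F ∘F F')
lam F ∘F F' = lam (F ∘F F')
bang F ∘F F' = bang (F ∘F F')
der F ∘F F' = der (F ∘F F')
esL F s ∘F F' = esL (F ∘F F') s
esR s F ∘F F' = esR s (F ∘F F')

plugF-∘ : ∀ {n k m} (F : FCtx n k) (F' : FCtx k m) t → plugF F (plugF F' t) ≡ plugF (F ∘F F') t
plugF-∘ □ F' t = refl
plugF-∘ (appL F s) F' t = cong (_· s) (plugF-∘ F F' t)
plugF-∘ (appR s F) F' t = cong (s ·_) (plugF-∘ F F' t)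
plugF-∘ (lam F) F' t = cong lam (plugF-∘ F F' t)
plugF-∘ (bang F) F' t = cong bang (plugF-∘ F F' t)
plugF-∘ (der F) F' t = cong der (plugF-∘ F F' t)
plugF-∘ (esL F s) F' t = cong (λ z → es z s) (plugF-∘ F F' t)
plugF-∘ (esR s F) F' t = cong (es s) (plugF-∘ F F' t)

root→S : ∀ {n} {t u : Term n} → t ↦ u → t →S u
root→S r = _ , □ , _ , _ , refl , refl , r

→S-plug : ∀ {n m} (S : SCtx n m) {t u} → t →S u → plugS S t →S plugS S u
→S-plug S (_ , S' , a , b , refl , refl , r) =
  _ , S ∘S S' , a , b , plugS-∘ S S' a , plugS-∘ S S' b , r

→S*-plug : ∀ {n m} (S : SCtx n m) {t u} → t →S* u → plugS S t →S* plugS S u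
→S*-plug S = gmap (plugS S) (→S-plug S)

→S*-plugL : ∀ {n m} (L : LCtx n m) {X Y} → X →S* Y → plugL L X →S* plugL L Y
→S*-plugL □ h = h
→S*-plugL (L [ s ]) h = →S*-plug (esL □ s) (→S*-plugL L h)

root→F : ∀ {n} {t u : Term n} → t ↦ u → t →F u
root→F r = _ , □ , _ , _ , refl , refl , r

→F-plug : ∀ {n m} (F : FCtx n m) {t u} → t →F u → plugF F t →F plugF F u
→F-plug F (_ , F' , a , b , refl , refl , r) =
  _ , F ∘F F' , a , b , plugF-∘ F F' a , plugF-∘ F F' b , r

→F*-plug : ∀ {n m} (F : FCtx n m) {t u} → t →F* u → plugF F t →F* plugF F u
→F*-plug F = gmap (plugF F) (→F-plug F)

→F*-plugL : ∀ {n m} (L : LCtx n m) {X Y} → X →F* Y → plugL L X →F* plugL L Y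
→F*-plugL □ h = h
→F*-plugL (L [ s ]) h = →F*-plug (esL □ s) (→F*-plugL L h)

→I-plugS : ∀ {n m} {S : SCtx n m} → NonHole S → ∀ {t u} → t →I u → plugS S t →I plugS S u
→I-plugS {S = S} nh (_ , I , a , b , refl , refl , r) = _ , surf S nh I , a , b , refl , refl , r

→I*-plugS : ∀ {n m} {S : SCtx n m} → NonHole S → ∀ {t u} → t →I* u → plugS S t →I* plugS S u
→I*-plugS {S = S} nh = gmap (plugS S) (→I-plugS nh)

→I-bang : ∀ {n} {t u : Term n} → t →F u → bang t →I bang u
→I-bang (_ , F , a , b , refl , refl , r) = _ , bang F , a , b , refl , refl , r

→F-plugS : ∀ {n m} (S : SCtx n m) {t u} → t →F u → plugS S t →F plugS S u
→F-plugS □ h = h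
→F-plugS (appL S s) h = →F-plug (appL □ s) (→F-plugS S h)
→F-plugS (appR s S) h = →F-plug (appR s □) (→F-plugS S h)
→F-plugS (lam S) h = →F-plug (lam □) (→F-plugS S h)
→F-plugS (der S) h = →F-plug (der □) (→F-plugS S h)
→F-plugS (esL S s) h = →F-plug (esL □ s) (→F-plugS S h)
→F-plugS (esR s S) h = →F-plug (esR s □) (→F-plugS S h)

→F-plugI : ∀ {n m} (I : ICtx n m) {t u} → t →F u → plugI I t →F plugI I u
→F-plugI (bang F) h = →F-plug (bang F) h
→F-plugI (surf S _ I) h = →F-plugS S (→F-plugI I h)

→S⊆→F : ∀ {n} {t u : Term n} → t →S u → t →F u
→S⊆→F (_ , S , _ , _ , refl , refl , r) = →F-plugS S (root→F r)

→I⊆→F : ∀ {n} {t u : Term n} → t →I u → t →F u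
→I⊆→F (_ , I , _ , _ , refl , refl , r) = →F-plugI I (root→F r)

infix 4 _⇛_ _⇒I_ _⇛ₛ_

data _⇛_ {n : ℕ} : Term n → Term n → Set where
  pvar  : ∀ i → var i ⇛ var i
  papp  : ∀ {t t' u u'} → t ⇛ t' → u ⇛ u' → t · u ⇛ t' · u'
  plam  : ∀ {t t'} → t ⇛ t' → lam t ⇛ lam t'
  pbang : ∀ {t t'} → t ⇛ t' → bang t ⇛ bang t'
  pder  : ∀ {t t'} → t ⇛ t' → der t ⇛ der t'
  pes   : ∀ {t t' u u'} → t ⇛ t' → u ⇛ u' → es t u ⇛ es t' u'
  pdB   : ∀ {m} {L L' : LCtx n m} {t t' u u'} → Pointwise _⇛_ L L' → t ⇛ t' → u ⇛ u' →
          plugL L (lam t) · u ⇛ plugL L' (es t' (rename (wkL L') u'))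
  ps!   : ∀ {m} {L L' : LCtx n m} {t t' u u'} → t ⇛ t' → Pointwise _⇛_ L L' → u ⇛ u' →
          es t (plugL L (bang u)) ⇛ plugL L' (rename (liftR (wkL L')) t' ⟦0≔ u' ⟧)
  pd!   : ∀ {m} {L L' : LCtx n m} {t t'} → Pointwise _⇛_ L L' → t ⇛ t' →
          der (plugL L (bang t)) ⇛ plugL L' t'

data _⇒I_ {n : ℕ} : Term n → Term n → Set where
  ivar  : ∀ i → var i ⇒I var i
  iapp  : ∀ {t t' u u'} → t ⇒I t' → u ⇒I u' → t · u ⇒I t' · u'
  ilam  : ∀ {t t'} → t ⇒I t' → lam t ⇒I lam t'
  ibang : ∀ {t t'} → t ⇛ t' → bang t ⇒I bang t'
  ider  : ∀ {t t'} → t ⇒I t' → der t ⇒I der t'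
  ies   : ∀ {t t' u u'} → t ⇒I t' → u ⇒I u' → es t u ⇒I es t' u'

_⇛ₛ_ : ∀ {n m} → Sub n m → Sub n m → Set
σ ⇛ₛ σ' = ∀ i → σ i ⇛ σ' i

⇛-refl : ∀ {n} (t : Term n) → t ⇛ t
⇛-refl (var i) = pvar i
⇛-refl (t · u) = papp (⇛-refl t) (⇛-refl u)
⇛-refl (lam t) = plam (⇛-refl t)
⇛-refl (bang t) = pbang (⇛-refl t)
⇛-refl (der t) = pder (⇛-refl t)
⇛-refl (es t u) = pes (⇛-refl t) (⇛-refl u)

⇒I⊆⇛ : ∀ {n} {t t' : Term n} → t ⇒I t' → t ⇛ t'
⇒I⊆⇛ (ivar i) = pvar i
⇒I⊆⇛ (iapp d e) = papp (⇒I⊆⇛ d) (⇒I⊆⇛ e)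
⇒I⊆⇛ (ilam d) = plam (⇒I⊆⇛ d)
⇒I⊆⇛ (ibang p) = pbang p
⇒I⊆⇛ (ider d) = pder (⇒I⊆⇛ d)
⇒I⊆⇛ (ies d e) = pes (⇒I⊆⇛ d) (⇒I⊆⇛ e)

⇒Iₗ-plugL-⇛ : ∀ {n m} {L L' : LCtx n m} {X X'} →
  Pointwise _⇒I_ L L' → X ⇛ X' → plugL L X ⇛ plugL L' X'
⇒Iₗ-plugL-⇛ l = Pointwise-plugL pes (Pointwise-map ⇒I⊆⇛ l)

-- Going under the list context of a redex, a substitution σ becomes a lifted
-- substitution τ on the hole, and the contexts become substituted ones K, K'.
-- Instantiated first with pointwise equality, which yields renaming (needed to lift ⇛ₛ
-- under binders), then with pointwise ⇛.

module ParallelSubst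
  (_≈_ : ∀ {n m} → Sub n m → Sub n m → Set)
  (≈-lift : ∀ {n m} {σ σ' : Sub n m} → σ ≈ σ' → liftS σ ≈ liftS σ')
  (≈⇒⇛ : ∀ {n m} {σ σ' : Sub n m} → σ ≈ σ' → σ ⇛ₛ σ')
  where

  record Pushed {n n' m} (σ σ' : Sub n n') (L L' : LCtx n m) : Set where
    constructor pushed
    field
      m'      : ℕ
      K K'    : LCtx n' m'
      τ τ'    : Sub m m'
      plug    : ∀ X → subst σ (plugL L X) ≡ plugL K (subst τ X)
      plug'   : ∀ X → subst σ' (plugL L' X) ≡ plugL K' (subst τ' X)
      weaken  : τ ∘ wkL L ≗ rename (wkL K) ∘ σ
      weaken' : τ' ∘ wkL L' ≗ rename (wkL K') ∘ σ'
      K⇛K'    : Pointwise _⇛_ K K'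
      τ≈τ'    : τ ≈ τ'

  mutual
    ⇛-subst : ∀ {n n'} {σ σ' : Sub n n'} {t t'} → t ⇛ t' → σ ≈ σ' → subst σ t ⇛ subst σ' t'
    ⇛-subst (pvar i) σ≈σ' = ≈⇒⇛ σ≈σ' i
    ⇛-subst (papp d e) σ≈σ' = papp (⇛-subst d σ≈σ') (⇛-subst e σ≈σ')
    ⇛-subst (plam d) σ≈σ' = plam (⇛-subst d (≈-lift σ≈σ'))
    ⇛-subst (pbang d) σ≈σ' = pbang (⇛-subst d σ≈σ')
    ⇛-subst (pder d) σ≈σ' = pder (⇛-subst d σ≈σ')
    ⇛-subst (pes d e) σ≈σ' = pes (⇛-subst d (≈-lift σ≈σ')) (⇛-subst e σ≈σ')
    ⇛-subst {σ = σ} {σ'} (pdB {t = t} {t'} {u} {u'} l d e) σ≈σ' =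
      subst₂ _⇛_ (cong (_· subst σ u) (sym (plug (lam t))))
        (sym (trans (plug' _)
          (cong (plugL K' ∘ es (subst (liftS τ') t')) (subst-rename-commute weaken' u'))))
        (pdB K⇛K' (⇛-subst d (≈-lift τ≈τ')) (⇛-subst e σ≈σ'))
      where open Pushed (push l σ≈σ')
    ⇛-subst {σ = σ} {σ'} (ps! {t = t} {t'} {u} {u'} d l e) σ≈σ' =
      subst₂ _⇛_ (cong (es (subst (liftS σ) t)) (sym (plug (bang u))))
        (sym (trans (plug' _) (cong (plugL K') (subst-⟦0≔⟧ weaken' t' u'))))
        (ps! (⇛-subst d (≈-lift σ≈σ')) K⇛K' (⇛-subst e τ≈τ'))
      where open Pushed (push l σ≈σ')
    ⇛-subst (pd! {t = t} {t'} l d) σ≈σ' =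
      subst₂ _⇛_ (cong der (sym (plug (bang t)))) (sym (plug' t'))
        (pd! K⇛K' (⇛-subst d τ≈τ'))
      where open Pushed (push l σ≈σ')

    push : ∀ {n n' m} {σ σ' : Sub n n'} {L L' : LCtx n m} →
      Pointwise _⇛_ L L' → σ ≈ σ' → Pushed σ σ' L L'
    push {σ = σ} {σ'} □ σ≈σ' =
      pushed _ □ □ σ σ' (λ _ → refl) (λ _ → refl)
        (λ i → sym (rename-id (σ i))) (λ i → sym (rename-id (σ' i))) □ σ≈σ'
    push {σ = σ} {σ'} (_[_] {s = s} {s'} l d) σ≈σ' =
      pushed _ (K [ subst σ s ]) (K' [ subst σ' s' ]) τ τ'
        (λ X → cong (λ z → es z (subst σ s)) (plug X))
        (λ X → cong (λ z → es z (subst σ' s')) (plug' X))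
        (λ i → trans (weaken (suc i)) (rename-∘ (wkL K) suc (σ i)))
        (λ i → trans (weaken' (suc i)) (rename-∘ (wkL K') suc (σ' i)))
        (K⇛K' [ ⇛-subst d σ≈σ' ])
        τ≈τ'
      where open Pushed (push l (≈-lift σ≈σ'))

module Exact = ParallelSubst _≗_ liftS-cong
  (λ {_} {_} {σ} σ≗σ' i → transport (σ i ⇛_) (σ≗σ' i) (⇛-refl (σ i)))

⇛-rename : ∀ {n m} (ρ : Ren n m) {t t'} → t ⇛ t' → rename ρ t ⇛ rename ρ t'
⇛-rename ρ {t} {t'} d =
  subst₂ _⇛_ (sym (rename-as-subst ρ t)) (sym (rename-as-subst ρ t')) (Exact.⇛-subst d λ _ → refl)

⇛ₛ-lift : ∀ {n m} {σ σ' : Sub n m} → σ ⇛ₛ σ' → liftS σ ⇛ₛ liftS σ'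
⇛ₛ-lift p zero = pvar zero
⇛ₛ-lift p (suc i) = ⇛-rename suc (p i)

open ParallelSubst _⇛ₛ_ ⇛ₛ-lift id using (⇛-subst)

sub0-⇛ : ∀ {n} {u u' : Term n} → u ⇛ u' → sub0 u ⇛ₛ sub0 u'
sub0-⇛ p zero = p
sub0-⇛ p (suc i) = pvar i

push-subst : ∀ {n n' m} (σ : Sub n n') (L : LCtx n m) → Exact.Pushed σ σ L L
push-subst σ L = Exact.push (Pointwise-refl ⇛-refl L) (λ _ → refl)

↦-subst : ∀ {n m} (σ : Sub n m) {a b} → a ↦ b → subst σ a ↦ subst σ b
↦-subst σ (dB L t u) =
  subst₂ _↦_ (cong (_· subst σ u) (sym (plug (lam t))))
    (sym (trans (plug _)
      (cong (plugL K ∘ es (subst (liftS τ) t)) (subst-rename-commute weaken u))))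
    (dB K (subst (liftS τ) t) (subst σ u))
  where open Exact.Pushed (push-subst σ L)
↦-subst σ (s! t L u) =
  subst₂ _↦_ (cong (es (subst (liftS σ) t)) (sym (plug (bang u))))
    (sym (trans (plug _) (cong (plugL K) (subst-⟦0≔⟧ weaken t u))))
    (s! (subst (liftS σ) t) K (subst τ u))
  where open Exact.Pushed (push-subst σ L)
↦-subst σ (d! L t) =
  subst₂ _↦_ (cong der (sym (plug (bang t)))) (sym (plug t)) (d! K (subst τ t))
  where open Exact.Pushed (push-subst σ L)

⇒I-rename : ∀ {n m} (ρ : Ren n m) {t t'} → t ⇒I t' → rename ρ t ⇒I rename ρ t'
⇒I-rename ρ (ivar i) = ivar (ρ i)
⇒I-rename ρ (iapp d e) = iapp (⇒I-rename ρ d) (⇒I-rename ρ e)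
⇒I-rename ρ (ilam d) = ilam (⇒I-rename (liftR ρ) d)
⇒I-rename ρ (ibang p) = ibang (⇛-rename ρ p)
⇒I-rename ρ (ider d) = ider (⇒I-rename ρ d)
⇒I-rename ρ (ies d e) = ies (⇒I-rename (liftR ρ) d) (⇒I-rename ρ e)

↦-plugS-subst : ∀ {n m k} (σ : Sub n k) (S : SCtx n m) {a b} → a ↦ b →
  subst σ (plugS S a) →S subst σ (plugS S b)
↦-plugS-subst σ □ r = root→S (↦-subst σ r)
↦-plugS-subst σ (appL S s) r = →S-plug (appL □ (subst σ s)) (↦-plugS-subst σ S r)
↦-plugS-subst σ (appR s S) r = →S-plug (appR (subst σ s) □) (↦-plugS-subst σ S r)
↦-plugS-subst σ (lam S) r = →S-plug (lam □) (↦-plugS-subst (liftS σ) S r)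
↦-plugS-subst σ (der S) r = →S-plug (der □) (↦-plugS-subst σ S r)
↦-plugS-subst σ (esL S s) r = →S-plug (esL □ (subst σ s)) (↦-plugS-subst (liftS σ) S r)
↦-plugS-subst σ (esR s S) r = →S-plug (esR (subst (liftS σ) s) □) (↦-plugS-subst σ S r)

→S*-subst : ∀ {n k} (σ : Sub n k) {t u} → t →S* u → subst σ t →S* subst σ u
→S*-subst σ = gmap (subst σ) λ { (_ , S , _ , _ , refl , refl , r) → ↦-plugS-subst σ S r }

→S*-rename : ∀ {n k} (ρ : Ren n k) {t u} → t →S* u → rename ρ t →S* rename ρ u
→S*-rename ρ {t} {u} h =
  subst₂ _→S*_ (sym (rename-as-subst ρ t)) (sym (rename-as-subst ρ u)) (→S*-subst (var ∘ ρ) h)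

root⊆⇛ : ∀ {n} {a b : Term n} → a ↦ b → a ⇛ b
root⊆⇛ (dB L t u) = pdB (Pointwise-refl ⇛-refl L) (⇛-refl t) (⇛-refl u)
root⊆⇛ (s! t L u) = ps! (⇛-refl t) (Pointwise-refl ⇛-refl L) (⇛-refl u)
root⊆⇛ (d! L t) = pd! (Pointwise-refl ⇛-refl L) (⇛-refl t)

⇛-plugF : ∀ {n m} (F : FCtx n m) {a b} → a ⇛ b → plugF F a ⇛ plugF F b
⇛-plugF □ p = p
⇛-plugF (appL F s) p = papp (⇛-plugF F p) (⇛-refl s)
⇛-plugF (appR s F) p = papp (⇛-refl s) (⇛-plugF F p)
⇛-plugF (lam F) p = plam (⇛-plugF F p)
⇛-plugF (bang F) p = pbang (⇛-plugF F p)
⇛-plugF (der F) p = pder (⇛-plugF F p)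
⇛-plugF (esL F s) p = pes (⇛-plugF F p) (⇛-refl s)
⇛-plugF (esR s F) p = pes (⇛-refl s) (⇛-plugF F p)

→F⊆⇛ : ∀ {n} {t u : Term n} → t →F u → t ⇛ u
→F⊆⇛ (_ , F , _ , _ , refl , refl , r) = ⇛-plugF F (root⊆⇛ r)

mutual
  ⇛⊆→F* : ∀ {n} {t t' : Term n} → t ⇛ t' → t →F* t'
  ⇛⊆→F* (pvar i) = ε
  ⇛⊆→F* (papp {u = u} d e) = →F*-plug (appL □ u) (⇛⊆→F* d) ◅◅ →F*-plug (appR _ □) (⇛⊆→F* e)
  ⇛⊆→F* (plam d) = →F*-plug (lam □) (⇛⊆→F* d)
  ⇛⊆→F* (pbang d) = →F*-plug (bang □) (⇛⊆→F* d)
  ⇛⊆→F* (pder d) = →F*-plug (der □) (⇛⊆→F* d)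
  ⇛⊆→F* (pes {u = u} d e) = →F*-plug (esL □ u) (⇛⊆→F* d) ◅◅ →F*-plug (esR _ □) (⇛⊆→F* e)
  ⇛⊆→F* (pdB {L' = L'} {t} {t'} {u} {u'} l d e) =
    →F*-plug (appL □ u) (Pointwise⊆→F* l (lam t) ◅◅ →F*-plugL L' (→F*-plug (lam □) (⇛⊆→F* d)))
    ◅◅ →F*-plug (appR _ □) (⇛⊆→F* e)
    ◅◅ root→F (dB L' t' u') ◅ ε
  ⇛⊆→F* (ps! {L' = L'} {t' = t'} {u} {u'} d l e) =
    →F*-plug (esL □ _) (⇛⊆→F* d)
    ◅◅ →F*-plug (esR t' □) (Pointwise⊆→F* l (bang u) ◅◅ →F*-plugL L' (→F*-plug (bang □) (⇛⊆→F* e)))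
    ◅◅ root→F (s! t' L' u') ◅ ε
  ⇛⊆→F* (pd! {L' = L'} {t} {t'} l d) =
    →F*-plug (der □) (Pointwise⊆→F* l (bang t) ◅◅ →F*-plugL L' (→F*-plug (bang □) (⇛⊆→F* d)))
    ◅◅ root→F (d! L' t') ◅ ε

  Pointwise⊆→F* : ∀ {n m} {L L' : LCtx n m} → Pointwise _⇛_ L L' → ∀ X → plugL L X →F* plugL L' X
  Pointwise⊆→F* □ X = ε
  Pointwise⊆→F* (_[_] {L' = L'} {s} l d) X =
    →F*-plug (esL □ s) (Pointwise⊆→F* l X) ◅◅ →F*-plug (esR (plugL L' X) □) (⇛⊆→F* d)

⇒I⊆→I* : ∀ {n} {t t' : Term n} → t ⇒I t' → t →I* t'
⇒I⊆→I* (ivar i) = ε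
⇒I⊆→I* (iapp {u = u} d e) = →I*-plugS (appL □ u) (⇒I⊆→I* d) ◅◅ →I*-plugS (appR _ □) (⇒I⊆→I* e)
⇒I⊆→I* (ilam d) = →I*-plugS (lam □) (⇒I⊆→I* d)
⇒I⊆→I* (ibang p) = gmap bang →I-bang (⇛⊆→F* p)
⇒I⊆→I* (ider d) = →I*-plugS (der □) (⇒I⊆→I* d)
⇒I⊆→I* (ies {u = u} d e) = →I*-plugS (esL □ u) (⇒I⊆→I* d) ◅◅ →I*-plugS (esR _ □) (⇒I⊆→I* e)

infix 4 _→S*⇒I_ _→S*⇒Iₗ_

_→S*⇒I_ : ∀ {n} → Term n → Term n → Set
t →S*⇒I u = ∃[ s ] (t →S* s) × (s ⇒I u)

_→S*⇒Iₗ_ : ∀ {n m} → LCtx n m → LCtx n m → Set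
_→S*⇒Iₗ_ {m = m} L L' = ∃[ K ] (∀ (X : Term m) → plugL L X →S* plugL K X) × Pointwise _⇒I_ K L'

→S*⇒I-prepend : ∀ {n} {t s u : Term n} → t →S* s → s →S*⇒I u → t →S*⇒I u
→S*⇒I-prepend a (w , b , c) = w , a ◅◅ b , c

→S*⇒I-app : ∀ {n} {t t' u u' : Term n} → t →S*⇒I t' → u →S*⇒I u' → t · u →S*⇒I t' · u'
→S*⇒I-app (w₁ , a₁ , b₁) (w₂ , a₂ , b₂) =
  w₁ · w₂ , →S*-plug (appL □ _) a₁ ◅◅ →S*-plug (appR w₁ □) a₂ , iapp b₁ b₂

→S*⇒I-lam : ∀ {n} {t t' : Term (suc n)} → t →S*⇒I t' → lam t →S*⇒I lam t'
→S*⇒I-lam (w , a , b) = lam w , →S*-plug (lam □) a , ilam b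

→S*⇒I-der : ∀ {n} {t t' : Term n} → t →S*⇒I t' → der t →S*⇒I der t'
→S*⇒I-der (w , a , b) = der w , →S*-plug (der □) a , ider b

→S*⇒I-es : ∀ {n} {t t' : Term (suc n)} {u u' : Term n} →
  t →S*⇒I t' → u →S*⇒I u' → es t u →S*⇒I es t' u'
→S*⇒I-es (w₁ , a₁ , b₁) (w₂ , a₂ , b₂) =
  es w₁ w₂ , →S*-plug (esL □ _) a₁ ◅◅ →S*-plug (esR w₁ □) a₂ , ies b₁ b₂

→S*⇒I-rename : ∀ {n m} (ρ : Ren n m) {t t'} → t →S*⇒I t' → rename ρ t →S*⇒I rename ρ t'
→S*⇒I-rename ρ (w , a , b) = rename ρ w , →S*-rename ρ a , ⇒I-rename ρ b

→S*⇒I-plugL : ∀ {n m} {L L' : LCtx n m} {X X'} →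
  L →S*⇒Iₗ L' → X →S*⇒I X' → plugL L X →S*⇒I plugL L' X'
→S*⇒I-plugL (K , L→K , k) (w , a , b) = plugL K w , L→K _ ◅◅ →S*-plugL K a , Pointwise-plugL ies k b

→S*⇒I-lift : ∀ {n m} {σ σ' : Sub n m} →
  (∀ i → σ i →S*⇒I σ' i) → ∀ i → liftS σ i →S*⇒I liftS σ' i
→S*⇒I-lift f zero = var zero , ε , ivar zero
→S*⇒I-lift f (suc i) = →S*⇒I-rename suc (f i)

sub0-→S*⇒I : ∀ {n} {u u' : Term n} → u →S*⇒I u' → ∀ i → sub0 u i →S*⇒I sub0 u' i
sub0-→S*⇒I f zero = f
sub0-→S*⇒I f (suc i) = var i , ε , ivar i

-- Both hypotheses are needed: under a ! the step is an arbitrary ⇛, covered only by the first.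
→S*⇒I-subst : ∀ {n m} {σ σ' : Sub n m} {t t'} → t ⇒I t' → σ ⇛ₛ σ' →
  (∀ i → σ i →S*⇒I σ' i) → subst σ t →S*⇒I subst σ' t'
→S*⇒I-subst (ivar i) p f = f i
→S*⇒I-subst (iapp d e) p f = →S*⇒I-app (→S*⇒I-subst d p f) (→S*⇒I-subst e p f)
→S*⇒I-subst (ilam d) p f = →S*⇒I-lam (→S*⇒I-subst d (⇛ₛ-lift p) (→S*⇒I-lift f))
→S*⇒I-subst {σ = σ} (ibang {t = t} d) p f = bang (subst σ t) , ε , ibang (⇛-subst d p)
→S*⇒I-subst (ider d) p f = →S*⇒I-der (→S*⇒I-subst d p f)
→S*⇒I-subst (ies d e) p f =
  →S*⇒I-es (→S*⇒I-subst d (⇛ₛ-lift p) (→S*⇒I-lift f)) (→S*⇒I-subst e p f)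

dB-factorise : ∀ {n m} {L L' : LCtx n m} {t t' u u'} →
  L →S*⇒Iₗ L' → t →S*⇒I t' → u →S*⇒I u' →
  plugL L (lam t) · u →S*⇒I plugL L' (es t' (rename (wkL L') u'))
dB-factorise {L = L} {L'} {t} {t'} {u} {u'} lf tf uf =
  →S*⇒I-prepend (root→S (dB L t u) ◅ ε)
    (transport (λ z → _ →S*⇒I plugL L' (es t' z)) (rename-cong (wkL-irrelevant L L') u')
      (→S*⇒I-plugL lf (→S*⇒I-es tf (→S*⇒I-rename (wkL L) uf))))

s!-factorise : ∀ {n m} {L L' : LCtx n m} {t t' u u'} →
  t →S*⇒I t' → L →S*⇒Iₗ L' → u ⇛ u' → u →S*⇒I u' →
  es t (plugL L (bang u)) →S*⇒I plugL L' (rename (liftR (wkL L')) t' ⟦0≔ u' ⟧)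
s!-factorise {L = L} {L'} {t} {t'} {u} {u'} (t₀ , t→t₀ , t₀⇒t') lf u⇛u' uf =
  →S*⇒I-prepend (root→S (s! t L u) ◅ ε)
    (transport (λ z → _ →S*⇒I plugL L' (z ⟦0≔ u' ⟧))
      (rename-cong (liftR-cong (wkL-irrelevant L L')) t')
      (→S*⇒I-plugL lf contractum))
  where
  w = liftR (wkL L)
  contractum : rename w t ⟦0≔ u ⟧ →S*⇒I rename w t' ⟦0≔ u' ⟧
  contractum = →S*⇒I-prepend (→S*-subst (sub0 u) (→S*-rename w t→t₀))
    (→S*⇒I-subst (⇒I-rename w t₀⇒t') (sub0-⇛ u⇛u') (sub0-→S*⇒I uf))

d!-factorise : ∀ {n m} {L L' : LCtx n m} {t t'} →
  L →S*⇒Iₗ L' → t →S*⇒I t' → der (plugL L (bang t)) →S*⇒I plugL L' t'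
d!-factorise {L = L} {t = t} lf tf = →S*⇒I-prepend (root→S (d! L t) ◅ ε) (→S*⇒I-plugL lf tf)

mutual
  ⇛-factorise : ∀ {n} {t t' : Term n} → t ⇛ t' → t →S*⇒I t'
  ⇛-factorise (pvar i) = var i , ε , ivar i
  ⇛-factorise (papp d e) = →S*⇒I-app (⇛-factorise d) (⇛-factorise e)
  ⇛-factorise (plam d) = →S*⇒I-lam (⇛-factorise d)
  ⇛-factorise (pbang {t = t} d) = bang t , ε , ibang d
  ⇛-factorise (pder d) = →S*⇒I-der (⇛-factorise d)
  ⇛-factorise (pes d e) = →S*⇒I-es (⇛-factorise d) (⇛-factorise e)
  ⇛-factorise (pdB l d e) = dB-factorise (Pointwise-factorise l) (⇛-factorise d) (⇛-factorise e)
  ⇛-factorise (ps! d l e) = s!-factorise (⇛-factorise d) (Pointwise-factorise l) e (⇛-factorise e)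
  ⇛-factorise (pd! l d) = d!-factorise (Pointwise-factorise l) (⇛-factorise d)

  Pointwise-factorise : ∀ {n m} {L L' : LCtx n m} → Pointwise _⇛_ L L' → L →S*⇒Iₗ L'
  Pointwise-factorise □ = □ , (λ _ → ε) , □
  Pointwise-factorise (_[_] {s = s} l d) with Pointwise-factorise l | ⇛-factorise d
  ... | K , L→K , k | s₀ , s→s₀ , s₀⇒s' =
    K [ s₀ ] ,
    (λ X → →S*-plug (esL □ s) (L→K X) ◅◅ →S*-plug (esR (plugL K X) □) s→s₀) ,
    k [ s₀⇒s' ]

⇒I-plugL-inv : ∀ {n m} (L : LCtx n m) {s X} → s ⇒I plugL L X →
  ∃[ L₀ ] ∃[ X₀ ] (s ≡ plugL L₀ X₀) × Pointwise _⇒I_ L₀ L × (X₀ ⇒I X)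
⇒I-plugL-inv □ h = □ , _ , refl , □ , h
⇒I-plugL-inv (L [ r ]) (ies h₁ h₂) with ⇒I-plugL-inv L h₁
... | L₀ , X₀ , refl , l , x = L₀ [ _ ] , X₀ , refl , l [ h₂ ] , x

⇒I-↦-postpone : ∀ {n} {s a b : Term n} → s ⇒I a → a ↦ b → ∃[ s' ] (s ↦ s') × (s' ⇛ b)
⇒I-↦-postpone (iapp {u = u₀} h₁ h₂) (dB L t u) with ⇒I-plugL-inv L h₁
... | L₀ , _ , refl , l , ilam {t = t₀} h₀ =
  plugL L₀ (es t₀ (rename (wkL L₀) u₀)) , dB L₀ t₀ u₀ ,
  ⇒Iₗ-plugL-⇛ l (pes (⇒I⊆⇛ h₀)
    (transport (rename (wkL L₀) u₀ ⇛_) (rename-cong (wkL-irrelevant L₀ L) u)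
      (⇛-rename (wkL L₀) (⇒I⊆⇛ h₂))))
⇒I-↦-postpone (ies {t = t₀} h₁ h₂) (s! t L u) with ⇒I-plugL-inv L h₂
... | L₀ , _ , refl , l , ibang {t = u₀} p =
  plugL L₀ (rename (liftR (wkL L₀)) t₀ ⟦0≔ u₀ ⟧) , s! t₀ L₀ u₀ ,
  ⇒Iₗ-plugL-⇛ l
    (transport (λ z → _ ⇛ z ⟦0≔ u ⟧) (rename-cong (liftR-cong (wkL-irrelevant L₀ L)) t)
      (⇛-subst (⇛-rename (liftR (wkL L₀)) (⇒I⊆⇛ h₁)) (sub0-⇛ p)))
⇒I-↦-postpone (ider h) (d! L t) with ⇒I-plugL-inv L h
... | L₀ , _ , refl , l , ibang {t = t₀} p = plugL L₀ t₀ , d! L₀ t₀ , ⇒Iₗ-plugL-⇛ l p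

⇒I-plugS-postpone : ∀ {n m} (S : SCtx n m) {s a b} → s ⇒I plugS S a → a ↦ b →
  ∃[ s' ] (s →S s') × (s' ⇛ plugS S b)
⇒I-plugS-postpone □ h r with ⇒I-↦-postpone h r
... | s' , st , p = s' , root→S st , p
⇒I-plugS-postpone (appL S _) (iapp h₁ h₂) r with ⇒I-plugS-postpone S h₁ r
... | _ , st , p = _ , →S-plug (appL □ _) st , papp p (⇒I⊆⇛ h₂)
⇒I-plugS-postpone (appR _ S) (iapp h₁ h₂) r with ⇒I-plugS-postpone S h₂ r
... | _ , st , p = _ , →S-plug (appR _ □) st , papp (⇒I⊆⇛ h₁) p
⇒I-plugS-postpone (lam S) (ilam h) r with ⇒I-plugS-postpone S h r
... | _ , st , p = _ , →S-plug (lam □) st , plam p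
⇒I-plugS-postpone (der S) (ider h) r with ⇒I-plugS-postpone S h r
... | _ , st , p = _ , →S-plug (der □) st , pder p
⇒I-plugS-postpone (esL S _) (ies h₁ h₂) r with ⇒I-plugS-postpone S h₁ r
... | _ , st , p = _ , →S-plug (esL □ _) st , pes p (⇒I⊆⇛ h₂)
⇒I-plugS-postpone (esR _ S) (ies h₁ h₂) r with ⇒I-plugS-postpone S h₂ r
... | _ , st , p = _ , →S-plug (esR _ □) st , pes (⇒I⊆⇛ h₁) p

⇒I-→S-swap : ∀ {n} {s s' u : Term n} → s ⇒I s' → s' →S u → s →S*⇒I u
⇒I-→S-swap h (_ , S , _ , _ , refl , refl , r) with ⇒I-plugS-postpone S h r
... | _ , st , p = →S*⇒I-prepend (st ◅ ε) (⇛-factorise p)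

⇒I-→S*-swap : ∀ {n} {s s' u : Term n} → s ⇒I s' → s' →S* u → s →S*⇒I u
⇒I-→S*-swap h ε = _ , ε , h
⇒I-→S*-swap h (st ◅ sts) with ⇒I-→S-swap h st
... | _ , a , b = →S*⇒I-prepend a (⇒I-→S*-swap b sts)

→F*-factorise : ∀ {n} {t u : Term n} → t →F* u → ∃[ s ] (t →S* s) × Star _⇒I_ s u
→F*-factorise ε = _ , ε , ε
→F*-factorise (f ◅ fs) with ⇛-factorise (→F⊆⇛ f) | →F*-factorise fs
... | _ , t→a , a⇒t₁ | _ , t₁→s , s⇒*u with ⇒I-→S*-swap a⇒t₁ t₁→s
... | v , a→v , v⇒s = v , t→a ◅◅ a→v , v⇒s ◅ s⇒*u

corollary7 : ∀ {n : ℕ} (t u : Term n) →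
    (t →F* u) ⇔ (∃ λ s → (t →S* s) × (s →I* u))
corollary7 t u = mk⇔
  (λ t→u → let s , t→s , s⇒*u = →F*-factorise t→u in s , t→s , kleisliStar id ⇒I⊆→I* s⇒*u)
  (λ (s , t→s , s→u) → map →S⊆→F t→s ◅◅ map →I⊆→F s→u)
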